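{- Let $S\subseteq\mathbb{F}_2^n$ be a set of $n+1$ affinely independent points. Then $\mathrm{Cay}(\gamma_S)$ is isomorphic to the half hypercube graph $\frac{1}{2}Q_{n+1}$.
   Context: Points $x_1,\dots,x_m$ are affinely independent if no $x_i$ is a sum of an odd number of the others. $\gamma_S(a)=1$ if $a\neq0$ and $(a+S)\cap S\neq\emptyset$, else $0$; $\mathrm{Cay}(f)$ has vertex set $\mathbb{F}_2^n$ and edges $\{u,v\}$ with $f(u+v)=1$. The half hypercube graph $\frac12 Q_m$ has as vertices the vectors of even Hamming weight in $\mathbb{F}_2^m$, two being adjacent iff they differ in exactly $2$ coordinates (so $\frac12Q_{n+1}$ has $2^n$ vertices). -}

module Defs where

open import Data.Bool using (Bool; true; false; _xor_)
open import Data.Nat using (ℕ; suc; _+_; _*_)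
open import Data.Fin using (Fin)
open import Data.Fin.Subset using (Subset; _∈_; _∉_; ∣_∣; ⊥)
open import Data.Vec using (Vec; replicate; zipWith; foldr; _∷_; []; lookup; tabulate; count)
open import Data.Product using (Σ; ∃; _×_; _,_)
open import Relation.Binary.PropositionalEquality using (_≡_)
open import Relation.Nullary using (¬_)
open import Data.Bool using (if_then_else_; _≟_)
open import Function using (Inverse)
open import Level using (_⊔_)
open import Function.Bundles using (_⇔_; _↔_)

F₂^ : ℕ → Set
F₂^ n = Vec Bool n

_⊕_ : {n : ℕ} → F₂^ n → F₂^ n → F₂^ n
_⊕_ = zipWith _xor_

𝟎 : {n : ℕ} → F₂^ n
𝟎 = replicate _ false

sumOver : {m n : ℕ} → (Fin m → F₂^ n) → Subset m → F₂^ n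
sumOver {m} x T = go (tabulate (λ j → if lookup T j then x j else 𝟎))
  where
  go : {k : ℕ} → Vec (F₂^ _) k → F₂^ _
  go = foldr _ _⊕_ 𝟎

Odd : ℕ → Set
Odd k = ∃ λ q → k ≡ suc (2 * q)

Even : ℕ → Set
Even k = ∃ λ q → k ≡ 2 * q

AffinelyIndependent : {m n : ℕ} → (Fin m → F₂^ n) → Set
AffinelyIndependent {m} x =
  ∀ (i : Fin m) (T : Subset m) → i ∉ T → Odd ∣ T ∣ → ¬ (x i ≡ sumOver x T)

-- membership in the set S = image of the family x
InImage : {m n : ℕ} → (Fin m → F₂^ n) → F₂^ n → Set
InImage x v = ∃ λ i → x i ≡ v

γ : {m n : ℕ} → (Fin m → F₂^ n) → F₂^ n → Set
γ x a = ¬ (a ≡ 𝟎) × ∃ λ s → InImage x s × InImage x (a ⊕ s)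

CayAdj : {n : ℕ} → (F₂^ n → Set) → F₂^ n → F₂^ n → Set
CayAdj f u v = f (u ⊕ v)

weight : {m : ℕ} → F₂^ m → ℕ
weight v = count (λ b → b ≟ true) v

hamming : {m : ℕ} → F₂^ m → F₂^ m → ℕ
hamming u v = weight (u ⊕ v)

HalfCubeVertex : ℕ → Set
HalfCubeVertex m = Σ (F₂^ m) (λ v → Even (weight v))

HalfCubeAdj : {m : ℕ} → HalfCubeVertex m → HalfCubeVertex m → Set
HalfCubeAdj (u , _) (v , _) = hamming u v ≡ 2

record GraphIso {a b r s} {V : Set a} {W : Set b}
                (E : V → V → Set r) (F : W → W → Set s) : Set (a ⊔ b ⊔ r ⊔ s) where
  field
    bij : V ↔ W
  open Inverse bij public using (to)
  field
    adj : ∀ u v → E u v ⇔ F (to u) (to v)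

-- The map w ↦ Σ_{j ∈ w} x_j from even-weight vectors of F₂^(n+1) to F₂^n is additive, and
-- affine independence says precisely that no nonzero even w is sent to 0: if i ∈ w, then
-- x_i would be the sum over the odd set w ∖ {i}.  So the map is injective, hence bijective
-- since both sides have 2^n elements.  Its inverse is the isomorphism: u + v is a sum
-- x_i + x_j of two distinct points of S exactly when the preimages of u and v differ by
-- e_i + e_j, i.e. lie at Hamming distance 2.

{-# OPTIONS --safe #-}
module Submission where

open import Defs
open import Algebra.Bundles using (CommutativeRing)
open import Data.Bool using (Bool; true; false; _xor_; if_then_else_)
open import Data.Bool.Properties
  using ( xor-comm; xor-assoc; xor-identityˡ; xor-identityʳ; xor-same; not-injective
        ; xor-∧-commutativeRing)
open import Algebra.Properties.CommutativeSemigroup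
  (CommutativeRing.+-commutativeSemigroup xor-∧-commutativeRing)
  using () renaming (interchange to xor-interchange)
open import Data.Nat using (ℕ; zero; suc; _^_)
open import Data.Nat.Properties using (*-suc; even≢odd; *-cancelˡ-≡; ≡-irrelevant; 1+n≰n)
import Data.Nat.Properties as ℕₚ
open import Data.Fin using (Fin; zero; suc; punchOut; _≟_)
open import Data.Fin.Properties using (any?; punchOut-injective; injective⇒≤; *↔×; 2↔Bool)
import Data.Fin.Properties as Finₚ
open import Data.Fin.Subset using (Subset; ⊥; ⁅_⁆; _∈_; _∉_; ∣_∣)
open import Data.Fin.Subset.Properties
  using (nonempty?; Empty-unique; x∈⁅x⁆; ∣⁅x⁆∣≡1; x≢y⇒x∉⁅y⁆)
open import Data.Vec using ([]; _∷_; tail; uncons; here; there)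
open import Data.Vec.Relation.Binary.Pointwise.Inductive
  using (Pointwise-≡⇒≡; zipWith-comm; zipWith-assoc; zipWith-identityˡ; zipWith-identityʳ)
open import Data.Product using (∃; ∃₂; _×_; _,_; proj₁; uncurry)
open import Data.Product.Function.NonDependent.Propositional using (_×-↔_)
open import Function using (_∘_)
open import Function.Bundles using (Inverse; Injection; _⇔_; _↔_; mk↔ₛ′; mk⇔; mk⤖)
open import Function.Consequences.Propositional using (strictlySurjective⇒surjective)
open import Function.Construct.Composition using (_⇔-∘_)
open import Function.Construct.Symmetry using (↔-sym)
open import Function.Definitions using (Injective; StrictlySurjective)
open import Function.Properties.Bijection using (⤖⇒↔)
open import Function.Properties.Inverse using (↔⇒↣; ↔-trans)
open import Relation.Nullary using (¬_; yes; no; contradiction)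
open import Relation.Binary.PropositionalEquality
  using (_≡_; _≢_; refl; sym; trans; cong; cong₂; subst; module ≡-Reasoning)

⊕-comm : ∀ {n} (u v : F₂^ n) → u ⊕ v ≡ v ⊕ u
⊕-comm u v = Pointwise-≡⇒≡ (zipWith-comm xor-comm u v)

⊕-assoc : ∀ {n} (u v w : F₂^ n) → (u ⊕ v) ⊕ w ≡ u ⊕ (v ⊕ w)
⊕-assoc u v w = Pointwise-≡⇒≡ (zipWith-assoc xor-assoc u v w)

⊕-identityˡ : ∀ {n} (u : F₂^ n) → 𝟎 ⊕ u ≡ u
⊕-identityˡ u = Pointwise-≡⇒≡ (zipWith-identityˡ xor-identityˡ u)

⊕-identityʳ : ∀ {n} (u : F₂^ n) → u ⊕ 𝟎 ≡ u
⊕-identityʳ u = Pointwise-≡⇒≡ (zipWith-identityʳ xor-identityʳ u)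

⊕-self : ∀ {n} (u : F₂^ n) → u ⊕ u ≡ 𝟎
⊕-self []      = refl
⊕-self (a ∷ u) = cong₂ _∷_ (xor-same a) (⊕-self u)

⊕-interchange : ∀ {n} (u v w z : F₂^ n) → (u ⊕ v) ⊕ (w ⊕ z) ≡ (u ⊕ w) ⊕ (v ⊕ z)
⊕-interchange []      []      []      []      = refl
⊕-interchange (a ∷ u) (b ∷ v) (c ∷ w) (d ∷ z) =
  cong₂ _∷_ (xor-interchange a b c d) (⊕-interchange u v w z)

⊕-cancelʳ : ∀ {n} (u v : F₂^ n) → (u ⊕ v) ⊕ v ≡ u
⊕-cancelʳ u v = begin
  (u ⊕ v) ⊕ v ≡⟨ ⊕-assoc u v v ⟩
  u ⊕ (v ⊕ v) ≡⟨ cong (u ⊕_) (⊕-self v) ⟩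
  u ⊕ 𝟎       ≡⟨ ⊕-identityʳ u ⟩
  u           ∎
  where open ≡-Reasoning

⊕≡𝟎⇒≡ : ∀ {n} (u v : F₂^ n) → u ⊕ v ≡ 𝟎 → u ≡ v
⊕≡𝟎⇒≡ u v eq = begin
  u           ≡⟨ sym (⊕-cancelʳ u v) ⟩
  (u ⊕ v) ⊕ v ≡⟨ cong (_⊕ v) eq ⟩
  𝟎 ⊕ v       ≡⟨ ⊕-identityˡ v ⟩
  v           ∎
  where open ≡-Reasoning

xor≡false⇒≡ : ∀ a b → a xor b ≡ false → a ≡ b
xor≡false⇒≡ false _ eq = sym eq
xor≡false⇒≡ true  _ eq = not-injective (sym eq)

parity : ∀ {m} → F₂^ m → Bool
parity []      = false
parity (b ∷ v) = b xor parity v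

parity-⊕ : ∀ {m} (u v : F₂^ m) → parity (u ⊕ v) ≡ parity u xor parity v
parity-⊕ []      []      = refl
parity-⊕ (a ∷ u) (b ∷ v) =
  trans (cong ((a xor b) xor_) (parity-⊕ u v)) (xor-interchange a b (parity u) (parity v))

parity-⊥ : ∀ m → parity (⊥ {m}) ≡ false
parity-⊥ zero    = refl
parity-⊥ (suc m) = parity-⊥ m

parity-⁅⁆ : ∀ {m} (i : Fin m) → parity ⁅ i ⁆ ≡ true
parity-⁅⁆ {suc m} zero = cong (true xor_) (parity-⊥ m)
parity-⁅⁆ (suc i)      = parity-⁅⁆ i

parity-⁅⁆⊕⁅⁆ : ∀ {m} (i j : Fin m) → parity (⁅ i ⁆ ⊕ ⁅ j ⁆) ≡ false
parity-⁅⁆⊕⁅⁆ i j = trans (parity-⊕ ⁅ i ⁆ ⁅ j ⁆) (cong₂ _xor_ (parity-⁅⁆ i) (parity-⁅⁆ j))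

Even⇒Odd-suc : ∀ {k} → Even k → Odd (suc k)
Even⇒Odd-suc (q , refl) = q , refl

Odd⇒Even-suc : ∀ {k} → Odd k → Even (suc k)
Odd⇒Even-suc (q , refl) = suc q , sym (*-suc 2 q)

Even⇒¬Odd : ∀ {k} → Even k → ¬ Odd k
Even⇒¬Odd (q , refl) (r , eq) = even≢odd q r eq

Even-irrelevant : ∀ {k} (e e′ : Even k) → e ≡ e′
Even-irrelevant (q , p) (q′ , p′) with *-cancelˡ-≡ q q′ 2 (trans (sym p) p′)
... | refl = cong (q ,_) (≡-irrelevant p p′)

parity≡false⇒Even : ∀ {m} (v : F₂^ m) → parity v ≡ false → Even (weight v)
parity≡true⇒Odd   : ∀ {m} (v : F₂^ m) → parity v ≡ true → Odd (weight v)
parity≡false⇒Even []          _  = 0 , refl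
parity≡false⇒Even (false ∷ v) eq = parity≡false⇒Even v eq
parity≡false⇒Even (true ∷ v)  eq = Odd⇒Even-suc (parity≡true⇒Odd v (not-injective eq))
parity≡true⇒Odd   (false ∷ v) eq = parity≡true⇒Odd v eq
parity≡true⇒Odd   (true ∷ v)  eq = Even⇒Odd-suc (parity≡false⇒Even v (not-injective eq))

Even⇒parity≡false : ∀ {m} (v : F₂^ m) → Even (weight v) → parity v ≡ false
Even⇒parity≡false v e with parity v in eq
... | false = refl
... | true  = contradiction (parity≡true⇒Odd v eq) (Even⇒¬Odd e)

weight≡0⇒≡⊥ : ∀ {m} (d : F₂^ m) → weight d ≡ 0 → d ≡ ⊥
weight≡0⇒≡⊥ []          _  = refl
weight≡0⇒≡⊥ (false ∷ d) eq = cong (false ∷_) (weight≡0⇒≡⊥ d eq)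
weight≡0⇒≡⊥ (true ∷ d)  ()

weight≡1⇒⁅⁆ : ∀ {m} (d : F₂^ m) → weight d ≡ 1 → ∃ λ i → d ≡ ⁅ i ⁆
weight≡1⇒⁅⁆ []          ()
weight≡1⇒⁅⁆ (false ∷ d) eq =
  let i , d≡⁅i⁆ = weight≡1⇒⁅⁆ d eq in suc i , cong (false ∷_) d≡⁅i⁆
weight≡1⇒⁅⁆ (true ∷ d)  eq = zero , cong (true ∷_) (weight≡0⇒≡⊥ d (ℕₚ.suc-injective eq))

weight≡2⇒⁅⁆⊕⁅⁆ : ∀ {m} (d : F₂^ m) → weight d ≡ 2 →
  ∃₂ λ i j → i ≢ j × d ≡ ⁅ i ⁆ ⊕ ⁅ j ⁆
weight≡2⇒⁅⁆⊕⁅⁆ []          ()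
weight≡2⇒⁅⁆⊕⁅⁆ (false ∷ d) eq =
  let i , j , i≢j , d≡ = weight≡2⇒⁅⁆⊕⁅⁆ d eq
  in  suc i , suc j , i≢j ∘ Finₚ.suc-injective , cong (false ∷_) d≡
weight≡2⇒⁅⁆⊕⁅⁆ (true ∷ d)  eq =
  let j , d≡⁅j⁆ = weight≡1⇒⁅⁆ d (ℕₚ.suc-injective eq)
  in  zero , suc j , (λ ()) , cong (true ∷_) (trans d≡⁅j⁆ (sym (⊕-identityˡ ⁅ j ⁆)))

weight-⁅⁆⊕⁅⁆ : ∀ {m} (i j : Fin m) → i ≢ j → weight (⁅ i ⁆ ⊕ ⁅ j ⁆) ≡ 2
weight-⁅⁆⊕⁅⁆ zero    zero    i≢j = contradiction refl i≢j
weight-⁅⁆⊕⁅⁆ zero    (suc j) _   = cong suc (trans (cong weight (⊕-identityˡ ⁅ j ⁆)) (∣⁅x⁆∣≡1 j))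
weight-⁅⁆⊕⁅⁆ (suc i) zero    _   = cong suc (trans (cong weight (⊕-identityʳ ⁅ i ⁆)) (∣⁅x⁆∣≡1 i))
weight-⁅⁆⊕⁅⁆ (suc i) (suc j) i≢j = weight-⁅⁆⊕⁅⁆ i j (i≢j ∘ cong suc)

∈⇒∉-⊕ : ∀ {m} {i : Fin m} {p q : Subset m} → i ∈ p → i ∈ q → i ∉ p ⊕ q
∈⇒∉-⊕ here        here        ()
∈⇒∉-⊕ (there i∈p) (there i∈q) (there i∈p⊕q) = ∈⇒∉-⊕ i∈p i∈q i∈p⊕q

sumOver-⊥ : ∀ {m n} (x : Fin m → F₂^ n) → sumOver x ⊥ ≡ 𝟎
sumOver-⊥ {zero}  x = refl
sumOver-⊥ {suc m} x = trans (⊕-identityˡ _) (sumOver-⊥ (x ∘ suc))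

if-xor : ∀ {n} a b (v : F₂^ n) →
  (if a xor b then v else 𝟎) ≡ (if a then v else 𝟎) ⊕ (if b then v else 𝟎)
if-xor false b     v = sym (⊕-identityˡ _)
if-xor true  false v = sym (⊕-identityʳ v)
if-xor true  true  v = sym (⊕-self v)

sumOver-⊕ : ∀ {m n} (x : Fin m → F₂^ n) (u v : Subset m) →
  sumOver x (u ⊕ v) ≡ sumOver x u ⊕ sumOver x v
sumOver-⊕ x []      []      = sym (⊕-identityˡ 𝟎)
sumOver-⊕ x (a ∷ u) (b ∷ v) =
  trans (cong₂ _⊕_ (if-xor a b (x zero)) (sumOver-⊕ (x ∘ suc) u v))
        (⊕-interchange _ _ _ _)

sumOver-⁅⁆ : ∀ {m n} (x : Fin m → F₂^ n) (i : Fin m) → sumOver x ⁅ i ⁆ ≡ x i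
sumOver-⁅⁆ x zero    = trans (cong (x zero ⊕_) (sumOver-⊥ (x ∘ suc))) (⊕-identityʳ _)
sumOver-⁅⁆ x (suc i) = trans (⊕-identityˡ _) (sumOver-⁅⁆ (x ∘ suc) i)

sumOver-⁅⁆⊕⁅⁆ : ∀ {m n} (x : Fin m → F₂^ n) (i j : Fin m) →
  sumOver x (⁅ i ⁆ ⊕ ⁅ j ⁆) ≡ x i ⊕ x j
sumOver-⁅⁆⊕⁅⁆ x i j = trans (sumOver-⊕ x ⁅ i ⁆ ⁅ j ⁆) (cong₂ _⊕_ (sumOver-⁅⁆ x i) (sumOver-⁅⁆ x j))

HalfCubeVertex-≡ : ∀ {m} {p q : HalfCubeVertex m} → proj₁ p ≡ proj₁ q → p ≡ q
HalfCubeVertex-≡ {p = v , e} {q = .v , e′} refl = cong (v ,_) (Even-irrelevant e e′)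

HalfCubeVertex-parity : ∀ {m} (p : HalfCubeVertex m) → parity (proj₁ p) ≡ false
HalfCubeVertex-parity (v , e) = Even⇒parity≡false v e

HalfCubeVertex-parity-⊕ : ∀ {m} (p q : HalfCubeVertex m) → parity (proj₁ p ⊕ proj₁ q) ≡ false
HalfCubeVertex-parity-⊕ p q = trans (parity-⊕ (proj₁ p) (proj₁ q))
  (cong₂ _xor_ (HalfCubeVertex-parity p) (HalfCubeVertex-parity q))

γ⇔sumOfDistinctPoints : ∀ {m n} (x : Fin m → F₂^ n) (c : F₂^ n) →
  γ x c ⇔ (∃₂ λ i j → x i ≢ x j × x i ⊕ x j ≡ c)
γ⇔sumOfDistinctPoints x c = mk⇔ to from
  where
  to : γ x c → ∃₂ λ i j → x i ≢ x j × x i ⊕ x j ≡ c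
  to (c≢𝟎 , s , (i , xi≡s) , (j , xj≡c⊕s)) = i , j , xi≢xj , sum
    where
    sum : x i ⊕ x j ≡ c
    sum = trans (cong₂ _⊕_ xi≡s xj≡c⊕s) (trans (⊕-comm s (c ⊕ s)) (⊕-cancelʳ c s))
    xi≢xj : x i ≢ x j
    xi≢xj xi≡xj = c≢𝟎 (trans (sym sum) (trans (cong (_⊕ x j) xi≡xj) (⊕-self (x j))))
  from : (∃₂ λ i j → x i ≢ x j × x i ⊕ x j ≡ c) → γ x c
  from (i , j , xi≢xj , sum) = c≢𝟎 , x i , (i , refl) , (j , xj≡c⊕xi)
    where
    c≢𝟎 : c ≢ 𝟎
    c≢𝟎 c≡𝟎 = xi≢xj (⊕≡𝟎⇒≡ (x i) (x j) (trans sum c≡𝟎))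
    xj≡c⊕xi : x j ≡ c ⊕ x i
    xj≡c⊕xi = begin
      x j               ≡⟨ sym (⊕-cancelʳ (x j) (x i)) ⟩
      (x j ⊕ x i) ⊕ x i ≡⟨ cong (_⊕ x i) (⊕-comm (x j) (x i)) ⟩
      (x i ⊕ x j) ⊕ x i ≡⟨ cong (_⊕ x i) sum ⟩
      c ⊕ x i           ∎
      where open ≡-Reasoning

module _ {m n} {x : Fin m → F₂^ n} (independent : AffinelyIndependent x) where

  AffinelyIndependent⇒injective : Injective _≡_ _≡_ x
  AffinelyIndependent⇒injective {i} {j} xi≡xj with i ≟ j
  ... | yes i≡j = i≡j
  ... | no  i≢j = contradiction (trans xi≡xj (sym (sumOver-⁅⁆ x j)))
                    (independent i ⁅ j ⁆ (x≢y⇒x∉⁅y⁆ i≢j) (0 , ∣⁅x⁆∣≡1 j))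

  evenKernel-trivial : ∀ w → parity w ≡ false → sumOver x w ≡ 𝟎 → w ≡ ⊥
  evenKernel-trivial w w-even w↦𝟎 with nonempty? w
  ... | no  w-empty     = Empty-unique w-empty
  ... | yes (i , i∈w) = contradiction (sym sumT≡xi) (independent i T i∉T T-odd)
    where
    T : Subset m
    T = w ⊕ ⁅ i ⁆
    i∉T : i ∉ T
    i∉T = ∈⇒∉-⊕ i∈w (x∈⁅x⁆ i)
    T-odd : Odd ∣ T ∣
    T-odd = parity≡true⇒Odd T (trans (parity-⊕ w ⁅ i ⁆) (cong₂ _xor_ w-even (parity-⁅⁆ i)))
    sumT≡xi : sumOver x T ≡ x i
    sumT≡xi = begin
      sumOver x (w ⊕ ⁅ i ⁆)          ≡⟨ sumOver-⊕ x w ⁅ i ⁆ ⟩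
      sumOver x w ⊕ sumOver x ⁅ i ⁆  ≡⟨ cong₂ _⊕_ w↦𝟎 (sumOver-⁅⁆ x i) ⟩
      𝟎 ⊕ x i                        ≡⟨ ⊕-identityˡ (x i) ⟩
      x i                            ∎
      where open ≡-Reasoning

  sameParity⇒sumOver-injective : ∀ {u v : Subset m} → parity u ≡ parity v →
    sumOver x u ≡ sumOver x v → u ≡ v
  sameParity⇒sumOver-injective {u} {v} pu≡pv su≡sv = ⊕≡𝟎⇒≡ u v (evenKernel-trivial (u ⊕ v)
    (trans (parity-⊕ u v) (trans (cong (_xor parity v) pu≡pv) (xor-same (parity v))))
    (trans (sumOver-⊕ x u v) (trans (cong (_⊕ sumOver x v) su≡sv) (⊕-self (sumOver x v)))))

  sumOfDistinctPoints⇔weight≡2 : ∀ d → parity d ≡ false →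
    (∃₂ λ i j → x i ≢ x j × x i ⊕ x j ≡ sumOver x d) ⇔ weight d ≡ 2
  sumOfDistinctPoints⇔weight≡2 d d-even = mk⇔ to from
    where
    to : (∃₂ λ i j → x i ≢ x j × x i ⊕ x j ≡ sumOver x d) → weight d ≡ 2
    to (i , j , xi≢xj , sum) =
      trans (cong weight (sym ⁅i⁆⊕⁅j⁆≡d)) (weight-⁅⁆⊕⁅⁆ i j (xi≢xj ∘ cong x))
      where
      ⁅i⁆⊕⁅j⁆≡d : ⁅ i ⁆ ⊕ ⁅ j ⁆ ≡ d
      ⁅i⁆⊕⁅j⁆≡d = sameParity⇒sumOver-injective (trans (parity-⁅⁆⊕⁅⁆ i j) (sym d-even))
                                               (trans (sumOver-⁅⁆⊕⁅⁆ x i j) sum)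
    from : weight d ≡ 2 → ∃₂ λ i j → x i ≢ x j × x i ⊕ x j ≡ sumOver x d
    from d-weight =
      let i , j , i≢j , d≡ = weight≡2⇒⁅⁆⊕⁅⁆ d d-weight
      in  i , j , i≢j ∘ AffinelyIndependent⇒injective
            , sym (trans (cong (sumOver x) d≡) (sumOver-⁅⁆⊕⁅⁆ x i j))

  γ-sumOver⇔weight≡2 : ∀ d → parity d ≡ false → γ x (sumOver x d) ⇔ weight d ≡ 2
  γ-sumOver⇔weight≡2 d d-even =
    sumOfDistinctPoints⇔weight≡2 d d-even ⇔-∘ γ⇔sumOfDistinctPoints x (sumOver x d)

  sumOver-HalfCubeVertex-injective :
    Injective _≡_ _≡_ (λ (p : HalfCubeVertex m) → sumOver x (proj₁ p))
  sumOver-HalfCubeVertex-injective {p} {q} = HalfCubeVertex-≡ ∘ sameParity⇒sumOver-injective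
    (trans (HalfCubeVertex-parity p) (sym (HalfCubeVertex-parity q)))

Fin-injective⇒strictlySurjective : ∀ {k} (f : Fin k → Fin k) →
  Injective _≡_ _≡_ f → StrictlySurjective _≡_ f
Fin-injective⇒strictlySurjective {suc k} f f-inj y with any? (λ i → f i ≟ y)
... | yes hit  = hit
... | no  miss = contradiction (injective⇒≤ g-inj) 1+n≰n
  where
  y≢f : ∀ i → y ≢ f i
  y≢f i y≡fi = miss (i , sym y≡fi)
  g : Fin (suc k) → Fin k
  g i = punchOut (y≢f i)
  g-inj : Injective _≡_ _≡_ g
  g-inj eq = f-inj (punchOut-injective (y≢f _) (y≢f _) eq)

injective⇒↔ : ∀ {a b} {A : Set a} {B : Set b} {k} → A ↔ Fin k → B ↔ Fin k →
  (f : A → B) → Injective _≡_ _≡_ f → A ↔ B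
injective⇒↔ {k = k} A↔k B↔k f f-inj = ⤖⇒↔ (mk⤖ (f-inj , strictlySurjective⇒surjective f-surj))
  where
  open Inverse
  g : Fin k → Fin k
  g = to B↔k ∘ f ∘ from A↔k
  g-inj : Injective _≡_ _≡_ g
  g-inj eq = Injection.injective (↔⇒↣ (↔-sym A↔k)) (f-inj (Injection.injective (↔⇒↣ B↔k) eq))
  f-surj : StrictlySurjective _≡_ f
  f-surj b = let i , gi≡b = Fin-injective⇒strictlySurjective g g-inj (to B↔k b)
             in  from A↔k i , Injection.injective (↔⇒↣ B↔k) gi≡b

F₂^↔Fin : ∀ m → F₂^ m ↔ Fin (2 ^ m)
F₂^↔Fin zero    = mk↔ₛ′ (λ _ → zero) (λ _ → []) (λ { zero → refl }) (λ { [] → refl })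
F₂^↔Fin (suc m) =
  ↔-trans ∷↔× (↔-trans (↔-sym 2↔Bool ×-↔ F₂^↔Fin m) (↔-sym (*↔× {2} {2 ^ m})))
  where
  ∷↔× : F₂^ (suc m) ↔ (Bool × F₂^ m)
  ∷↔× = mk↔ₛ′ uncons (uncurry _∷_) (λ _ → refl) (λ { (_ ∷ _) → refl })

HalfCubeVertex↔F₂^ : ∀ m → HalfCubeVertex (suc m) ↔ F₂^ m
HalfCubeVertex↔F₂^ m = mk↔ₛ′ (tail ∘ proj₁) withParity (λ _ → refl) withParity∘tail
  where
  withParity : F₂^ m → HalfCubeVertex (suc m)
  withParity v = parity v ∷ v , parity≡false⇒Even (parity v ∷ v) (xor-same (parity v))
  withParity∘tail : ∀ p → withParity (tail (proj₁ p)) ≡ p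
  withParity∘tail p@(b ∷ v , _) =
    HalfCubeVertex-≡ (cong (_∷ v) (sym (xor≡false⇒≡ b (parity v) (HalfCubeVertex-parity p))))

proposition4p4 : (n : ℕ) (x : Fin (suc n) → F₂^ n) → AffinelyIndependent x →
    GraphIso (CayAdj {n} (γ x)) (HalfCubeAdj {suc n})
proposition4p4 n x independent = record { bij = ↔-sym vertices ; adj = adjacency }
  where
  vertices : HalfCubeVertex (suc n) ↔ F₂^ n
  vertices = injective⇒↔ (↔-trans (HalfCubeVertex↔F₂^ n) (F₂^↔Fin n)) (F₂^↔Fin n)
                         (sumOver x ∘ proj₁) (sumOver-HalfCubeVertex-injective independent)
  open Inverse vertices using (from; strictlyInverseˡ)

  adjacency : ∀ a b → γ x (a ⊕ b) ⇔ HalfCubeAdj (from a) (from b)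
  adjacency a b = subst (λ c → γ x c ⇔ weight d ≡ 2) sumOver-d
    (γ-sumOver⇔weight≡2 independent d (HalfCubeVertex-parity-⊕ (from a) (from b)))
    where
    d : F₂^ (suc n)
    d = proj₁ (from a) ⊕ proj₁ (from b)
    sumOver-d : sumOver x d ≡ a ⊕ b
    sumOver-d = trans (sumOver-⊕ x (proj₁ (from a)) (proj₁ (from b)))
                      (cong₂ _⊕_ (strictlyInverseˡ a) (strictlyInverseˡ b))
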